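{- For all integers $m\ge0$ and $k\ge1$, $$\sum_{j=0}^{m}(-1)^j\,e_{m-j}(\mathbf x)\,s_{(j+2,2^{k-1})}(\mathbf x)=s_{(2^k,1^m)}(\mathbf x).$$
   Context: $e_r(\mathbf x)$ is the elementary symmetric function of degree $r$ (with $e_0=1$) and $s_\lambda(\mathbf x)$ is the Schur function indexed by the partition $\lambda$, in variables $\mathbf x=(x_1,x_2,\dots)$. $(j+2,2^{k-1})$ denotes the partition with one part $j+2$ followed by $k-1$ parts equal to $2$, and $(2^k,1^m)$ the partition with $k$ parts $2$ and $m$ parts $1$. -}

module Defs where

open import Level using (Level)
open import Data.Nat using (ℕ; zero; suc; _∸_; _≤ᵇ_; _<ᵇ_)
open import Data.Fin using (Fin; toℕ)
open import Data.Bool using (Bool; true; false; _∧_; if_then_else_)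
open import Data.List using (List; []; _∷_; [_]; map; concat; concatMap; allFin; foldr; replicate; upTo; _++_)
open import Algebra.Bundles using (CommutativeRing)

filterᵇ : ∀ {a} {A : Set a} → (A → Bool) → List A → List A
filterᵇ p [] = []
filterᵇ p (x ∷ xs) = if p x then x ∷ filterᵇ p xs else filterᵇ p xs

allᵇ : ∀ {a} {A : Set a} → (A → Bool) → List A → Bool
allᵇ p [] = true
allᵇ p (x ∷ xs) = p x ∧ allᵇ p xs

allLists : (n l : ℕ) → List (List (Fin n))
allLists n zero = [ [] ]
allLists n (suc l) = concatMap (λ i → map (i ∷_) (allLists n l)) (allFin n)

-- all fillings (list of rows) of the Young diagram with row lengths λ
fillings : (n : ℕ) → List ℕ → List (List (List (Fin n)))
fillings n [] = [ [] ]
fillings n (l ∷ ls) = concatMap (λ r → map (r ∷_) (fillings n ls)) (allLists n l)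

weakInc : ∀ {n} → List (Fin n) → Bool
weakInc (a ∷ b ∷ rest) = (toℕ a ≤ᵇ toℕ b) ∧ weakInc (b ∷ rest)
weakInc _ = true

strictInc : ∀ {n} → List (Fin n) → Bool
strictInc (a ∷ b ∷ rest) = (toℕ a <ᵇ toℕ b) ∧ strictInc (b ∷ rest)
strictInc _ = true

-- entries of the lower row strictly exceed the entries directly above
colStrict : ∀ {n} → List (Fin n) → List (Fin n) → Bool
colStrict _ [] = true
colStrict [] (_ ∷ _) = false
colStrict (a ∷ as) (b ∷ bs) = (toℕ a <ᵇ toℕ b) ∧ colStrict as bs

colsOK : ∀ {n} → List (List (Fin n)) → Bool
colsOK (r₁ ∷ r₂ ∷ rs) = colStrict r₁ r₂ ∧ colsOK (r₂ ∷ rs)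
colsOK _ = true

isSSYT : ∀ {n} → List (List (Fin n)) → Bool
isSSYT T = allᵇ weakInc T ∧ colsOK T

module _ {c ℓ : Level} (R : CommutativeRing c ℓ) where
  open CommutativeRing R

  sumR : List Carrier → Carrier
  sumR = foldr _+_ 0#

  prodR : List Carrier → Carrier
  prodR = foldr _*_ 1#

  negOnePow : ℕ → Carrier
  negOnePow zero = 1#
  negOnePow (suc j) = - negOnePow j

  elem : ∀ {n} → (Fin n → Carrier) → ℕ → Carrier
  elem {n} x r = sumR (map (λ S → prodR (map x S)) (filterᵇ strictInc (allLists n r)))

  -- Schur polynomial s_λ(x_1,…,x_n) = Σ_{T ∈ SSYT(λ), entries ≤ n} x^T
  -- (λ given as the list of its parts, largest first)
  schur : ∀ {n} → (Fin n → Carrier) → List ℕ → Carrier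
  schur {n} x shape = sumR (map (λ T → prodR (map x (concat T))) (filterᵇ isSSYT (fillings n shape)))

  lhs : ∀ {n} → (Fin n → Carrier) → ℕ → ℕ → Carrier
  lhs x m k = sumR (map (λ j → negOnePow j * (elem x (m ∸ j) * schur x (suc (suc j) ∷ replicate (k ∸ 1) 2))) (upTo (suc m)))

  rhs : ∀ {n} → (Fin n → Carrier) → ℕ → ℕ → Carrier
  rhs x m k = schur x (replicate k 2 ++ replicate m 1)

-- Work with the variables X 0, …, X (N - 1) and induct on N, adjoining a new largest variable X N.
-- Expanding along the first row a ≤ b ≤ …, s_(j+2, 2^(k-1)) is the sum over tableaux T of shape (2^k)
-- of x^T h_j(X b, …, X (N - 1)), with b the top of the second column of T. Since
-- ∑_j (-1)^j e_(m-j)(X 0, …, X (N - 1)) h_j(X b, …, X (N - 1)) = e_m(X 0, …, X (b - 1))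
-- (adjoining X a multiplies E(t) by 1 + X a t and H(-t) by its inverse), the left-hand side is the sum
-- of x^T e_m(X 0, …, X (b - 1)). These weighted sums, taken over all shapes (2^q, 1^d), obey the same
-- recurrence in N as the two-column part ∑_i s_(2^(q+i), 1^(d+m-2i)) of the Pieri expansion of
-- s_(2^q, 1^d) e_m, so the two agree; for q = k and d = 0 this part is s_(2^k, 1^m) alone.

module Submission where

open import Defs
open import Data.Nat using (ℕ; _≤_)
open import Data.Fin using (Fin)
open import Algebra.Bundles using (CommutativeRing)

open import Data.Nat as ℕ using (zero; suc; _<_; _≤ᵇ_; _<ᵇ_; _∸_; z≤n; _≤′_; ≤′-refl; ≤′-step)
open import Data.Nat.Properties
  using (n<1+n; m<n⇒m<1+n; m<1+n⇒m≤n; ≤-refl; <⇒≤; <⇒≱; <-≤-trans; ≤⇒≤ᵇ; ≤ᵇ⇒≤; ≤′⇒≤; ≤⇒≤′)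
open import Data.Fin as Fin using (toℕ)
open import Data.Bool using (Bool; true; false; _∧_)
open import Data.Bool.Properties using (∧-identityʳ)
open import Data.List
  using (List; []; _∷_; [_]; map; concat; concatMap; replicate; allFin; tabulate; applyUpTo; _++_)
open import Data.List.Properties using (++-identityʳ)
open import Data.Maybe using (Maybe; just; nothing)
open import Function using (_∘_; id)
open import Relation.Nullary using (contradiction)
open import Relation.Binary.PropositionalEquality as ≡ using (_≡_)

extendBy : ∀ {a} {A : Set a} {n} → A → (Fin n → A) → ℕ → A
extendBy {n = zero} z x a = z
extendBy {n = suc n} z x zero = x Fin.zero
extendBy {n = suc n} z x (suc a) = extendBy z (x ∘ Fin.suc) a

extendBy-toℕ : ∀ {a} {A : Set a} {n} (z : A) (x : Fin n → A) i → extendBy z x (toℕ i) ≡ x i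
extendBy-toℕ z x Fin.zero = ≡.refl
extendBy-toℕ z x (Fin.suc i) = extendBy-toℕ z (x ∘ Fin.suc) i

module FiniteSums {c ℓ} (R : CommutativeRing c ℓ) where
  open CommutativeRing R hiding (zero)
  open import Relation.Binary.Reasoning.Setoid setoid
  open import Algebra.Properties.Ring ring using (-0#≈0#; -‿+-comm)
  open import Algebra.Properties.CommutativeSemigroup +-commutativeSemigroup using (interchange)
  open import Algebra.Properties.CommutativeSemigroup *-commutativeSemigroup
    using () renaming (x∙yz≈y∙xz to x*yz≈y*xz)

  ∑< : ℕ → (ℕ → Carrier) → Carrier
  ∑< zero f = 0#
  ∑< (suc N) f = ∑< N f + f N

  syntax ∑< N (λ a → f) = ∑[ a < N ] f

  ∑-cong : ∀ N {f g} → (∀ a → a < N → f a ≈ g a) → ∑< N f ≈ ∑< N g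
  ∑-cong zero f≈g = refl
  ∑-cong (suc N) f≈g = +-cong (∑-cong N λ a a<N → f≈g a (m<n⇒m<1+n a<N)) (f≈g N (n<1+n N))

  ∑-zero : ∀ N {f} → (∀ a → a < N → f a ≈ 0#) → ∑< N f ≈ 0#
  ∑-zero zero f≈0 = refl
  ∑-zero (suc N) f≈0 =
    trans (+-cong (∑-zero N λ a a<N → f≈0 a (m<n⇒m<1+n a<N)) (f≈0 N (n<1+n N))) (+-identityʳ 0#)

  ∑-distrib-+ : ∀ N f g → ∑[ a < N ] (f a + g a) ≈ ∑< N f + ∑< N g
  ∑-distrib-+ zero f g = sym (+-identityʳ 0#)
  ∑-distrib-+ (suc N) f g = trans (+-congʳ (∑-distrib-+ N f g)) (interchange _ _ _ _)

  *-distribˡ-∑ : ∀ N k f → k * ∑< N f ≈ ∑[ a < N ] (k * f a)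
  *-distribˡ-∑ zero k f = zeroʳ k
  *-distribˡ-∑ (suc N) k f = trans (distribˡ k _ _) (+-congʳ (*-distribˡ-∑ N k f))

  *-distribʳ-∑ : ∀ N k f → ∑< N f * k ≈ ∑[ a < N ] (f a * k)
  *-distribʳ-∑ zero k f = zeroˡ k
  *-distribʳ-∑ (suc N) k f = trans (distribʳ k _ _) (+-congʳ (*-distribʳ-∑ N k f))

  -‿∑ : ∀ N f → - ∑< N f ≈ ∑[ a < N ] (- f a)
  -‿∑ zero f = -0#≈0#
  -‿∑ (suc N) f = trans (sym (-‿+-comm _ _)) (+-congʳ (-‿∑ N f))

  ∑-linear : ∀ N (w u v : ℕ → Carrier) k →
    ∑[ a < N ] (w a * (u a + k * v a)) ≈ ∑[ a < N ] (w a * u a) + k * ∑[ a < N ] (w a * v a)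
  ∑-linear N w u v k = begin
    ∑[ a < N ] (w a * (u a + k * v a))          ≈⟨ ∑-cong N (λ a _ → distribˡ (w a) _ _) ⟩
    ∑[ a < N ] (w a * u a + w a * (k * v a))    ≈⟨ ∑-distrib-+ N _ _ ⟩
    ∑[ a < N ] (w a * u a) + ∑[ a < N ] (w a * (k * v a))
      ≈⟨ +-congˡ (trans (∑-cong N λ a _ → x*yz≈y*xz (w a) k (v a)) (sym (*-distribˡ-∑ N k _))) ⟩
    ∑[ a < N ] (w a * u a) + k * ∑[ a < N ] (w a * v a) ∎

  ∑-unconsˡ : ∀ N f → ∑< (suc N) f ≈ f 0 + ∑[ a < N ] f (suc a)
  ∑-unconsˡ zero f = trans (+-identityˡ _) (sym (+-identityʳ _))
  ∑-unconsˡ (suc N) f = trans (+-congʳ (∑-unconsˡ N f)) (+-assoc _ _ _)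

  𝟙[_]_ : Bool → Carrier → Carrier
  𝟙[ true ] v = v
  𝟙[ false ] v = 0#

  𝟙-cong : ∀ b {u v} → u ≈ v → 𝟙[ b ] u ≈ 𝟙[ b ] v
  𝟙-cong true u≈v = u≈v
  𝟙-cong false u≈v = refl

  𝟙-zero : ∀ b → 𝟙[ b ] 0# ≈ 0#
  𝟙-zero true = refl
  𝟙-zero false = refl

  𝟙-*ʳ : ∀ b u v → 𝟙[ b ] (u * v) ≈ 𝟙[ b ] u * v
  𝟙-*ʳ true u v = refl
  𝟙-*ʳ false u v = sym (zeroˡ v)

  𝟙-*ˡ : ∀ b u v → 𝟙[ b ] (u * v) ≈ u * 𝟙[ b ] v
  𝟙-*ˡ true u v = refl
  𝟙-*ˡ false u v = sym (zeroʳ u)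

  𝟙-∧ : ∀ a b v → 𝟙[ a ∧ b ] v ≈ 𝟙[ a ] (𝟙[ b ] v)
  𝟙-∧ true b v = refl
  𝟙-∧ false b v = refl

  𝟙-≤ᵇ-true : ∀ {m n} v → m ≤ n → 𝟙[ m ≤ᵇ n ] v ≈ v
  𝟙-≤ᵇ-true {m} {n} v m≤n with m ≤ᵇ n | ≤⇒≤ᵇ m≤n
  ... | true | _ = refl

  𝟙-≤ᵇ-false : ∀ {m n} v → n < m → 𝟙[ m ≤ᵇ n ] v ≈ 0#
  𝟙-≤ᵇ-false {m} {n} v n<m with m ≤ᵇ n | ≤ᵇ⇒≤ m n
  ... | false | _ = refl
  ... | true | m≤n = contradiction (m≤n _) (<⇒≱ n<m)

  module _ {a} {A : Set a} where
    ∑ᴸ : List A → (A → Carrier) → Carrier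
    ∑ᴸ xs f = sumR R (map f xs)

    syntax ∑ᴸ xs (λ t → f) = ∑[ t ∈ xs ] f

    ∑∈-cong : ∀ xs {f g} → (∀ t → f t ≈ g t) → ∑ᴸ xs f ≈ ∑ᴸ xs g
    ∑∈-cong [] f≈g = refl
    ∑∈-cong (t ∷ xs) f≈g = +-cong (f≈g t) (∑∈-cong xs f≈g)

    ∑∈-++ : ∀ xs ys f → ∑ᴸ (xs ++ ys) f ≈ ∑ᴸ xs f + ∑ᴸ ys f
    ∑∈-++ [] ys f = sym (+-identityˡ _)
    ∑∈-++ (t ∷ xs) ys f = trans (+-congˡ (∑∈-++ xs ys f)) (sym (+-assoc _ _ _))

    ∑∈-filter : ∀ xs p f → ∑ᴸ (filterᵇ p xs) f ≈ ∑[ t ∈ xs ] 𝟙[ p t ] (f t)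
    ∑∈-filter [] p f = refl
    ∑∈-filter (t ∷ xs) p f with p t
    ... | true = +-congˡ (∑∈-filter xs p f)
    ... | false = trans (∑∈-filter xs p f) (sym (+-identityˡ _))

    ∑∈-zero : ∀ xs → ∑[ t ∈ xs ] 0# ≈ 0#
    ∑∈-zero [] = refl
    ∑∈-zero (t ∷ xs) = trans (+-identityˡ _) (∑∈-zero xs)

    *-distribˡ-∑∈ : ∀ xs k f → k * ∑ᴸ xs f ≈ ∑[ t ∈ xs ] (k * f t)
    *-distribˡ-∑∈ [] k f = zeroʳ k
    *-distribˡ-∑∈ (t ∷ xs) k f = trans (distribˡ k _ _) (+-congˡ (*-distribˡ-∑∈ xs k f))

    ∑∈-𝟙-* : ∀ xs b y (B : A → Bool) (f : A → Carrier) →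
             ∑[ t ∈ xs ] 𝟙[ b ∧ B t ] (y * f t) ≈ 𝟙[ b ] y * ∑[ t ∈ xs ] 𝟙[ B t ] (f t)
    ∑∈-𝟙-* xs true y B f = sym (trans (*-distribˡ-∑∈ xs y _) (∑∈-cong xs λ t → sym (𝟙-*ˡ (B t) y (f t))))
    ∑∈-𝟙-* xs false y B f = trans (∑∈-zero xs) (sym (zeroˡ _))

    ∑∈-tabulate : ∀ n (h : Fin n → A) f g → (∀ i → f (h i) ≈ g (toℕ i)) → ∑ᴸ (tabulate h) f ≈ ∑< n g
    ∑∈-tabulate zero h f g fh≈g = refl
    ∑∈-tabulate (suc n) h f g fh≈g =
      trans (+-cong (fh≈g Fin.zero) (∑∈-tabulate n (h ∘ Fin.suc) f (g ∘ suc) (fh≈g ∘ Fin.suc)))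
            (sym (∑-unconsˡ n g))

    ∑∈-applyUpTo : ∀ M (h : ℕ → A) f → ∑ᴸ (applyUpTo h M) f ≈ ∑[ a < M ] f (h a)
    ∑∈-applyUpTo zero h f = refl
    ∑∈-applyUpTo (suc M) h f = trans (+-congˡ (∑∈-applyUpTo M (h ∘ suc) f)) (sym (∑-unconsˡ M (f ∘ h)))

  ∑∈-map : ∀ {a b} {A : Set a} {B : Set b} xs (g : A → B) f → ∑ᴸ (map g xs) f ≈ ∑ᴸ xs (f ∘ g)
  ∑∈-map [] g f = refl
  ∑∈-map (t ∷ xs) g f = +-congˡ (∑∈-map xs g f)

  ∑∈-concatMap : ∀ {a b} {A : Set a} {B : Set b} xs (g : A → List B) f →
                 ∑ᴸ (concatMap g xs) f ≈ ∑[ t ∈ xs ] ∑ᴸ (g t) f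
  ∑∈-concatMap [] g f = refl
  ∑∈-concatMap (t ∷ xs) g f = trans (∑∈-++ (g t) _ f) (+-congˡ (∑∈-concatMap xs g f))

module AlternatingConvolution {c ℓ} (R : CommutativeRing c ℓ) where
  open CommutativeRing R hiding (zero)
  open FiniteSums R
  open import Relation.Binary.Reasoning.Setoid setoid
  open import Algebra.Properties.Ring ring using (-‿distribˡ-*; -‿distribʳ-*; -0#≈0#; -‿+-comm)
  open import Algebra.Properties.CommutativeSemigroup +-commutativeSemigroup using (interchange)
  open import Algebra.Properties.CommutativeSemigroup *-commutativeSemigroup
    using () renaming (x∙yz≈y∙xz to x*yz≈y*xz)

  shift : (ℕ → Carrier) → ℕ → Carrier
  shift f zero = 0#
  shift f (suc r) = f r

  shift-cong : ∀ {f g} r → (∀ r → f r ≈ g r) → shift f r ≈ shift g r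
  shift-cong zero f≈g = refl
  shift-cong (suc r) f≈g = f≈g r

  shift-*ˡ : ∀ k f r → shift (λ r → k * f r) r ≈ k * shift f r
  shift-*ˡ k f zero = sym (zeroʳ k)
  shift-*ˡ k f (suc r) = refl

  shift-*ʳ : ∀ f k r → shift (λ r → f r * k) r ≈ shift f r * k
  shift-*ʳ f k zero = sym (zeroˡ k)
  shift-*ʳ f k (suc r) = refl

  -- The m-th coefficient of F(t) G(-t).
  altConv : (ℕ → Carrier) → (ℕ → Carrier) → ℕ → Carrier
  altConv f g zero = f 0 * g 0
  altConv f g (suc m) = f (suc m) * g 0 + - altConv f (g ∘ suc) m

  altConv-as-∑ : ∀ m f g → ∑[ j < suc m ] (negOnePow R j * (f (m ∸ j) * g j)) ≈ altConv f g m
  altConv-as-∑ zero f g = trans (+-identityˡ _) (*-identityˡ _)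
  altConv-as-∑ (suc m) f g = trans (∑-unconsˡ (suc m) _) (+-cong (*-identityˡ _)
    (trans (∑-cong (suc m) λ j _ → sym (-‿distribˡ-* _ _))
           (trans (sym (-‿∑ (suc m) _)) (-‿cong (altConv-as-∑ m f (g ∘ suc))))))

  altConv-cong : ∀ m {f f′ g g′} → (∀ r → f r ≈ f′ r) → (∀ j → g j ≈ g′ j) →
                 altConv f g m ≈ altConv f′ g′ m
  altConv-cong zero f≈ g≈ = *-cong (f≈ 0) (g≈ 0)
  altConv-cong (suc m) f≈ g≈ = +-cong (*-cong (f≈ (suc m)) (g≈ 0)) (-‿cong (altConv-cong m f≈ (g≈ ∘ suc)))

  altConv-+ˡ : ∀ m f f′ g → altConv (λ r → f r + f′ r) g m ≈ altConv f g m + altConv f′ g m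
  altConv-+ˡ zero f f′ g = distribʳ _ _ _
  altConv-+ˡ (suc m) f f′ g = trans (+-cong (distribʳ _ _ _)
    (trans (-‿cong (altConv-+ˡ m f f′ (g ∘ suc))) (sym (-‿+-comm _ _)))) (interchange _ _ _ _)

  altConv-+ʳ : ∀ m f g g′ → altConv f (λ j → g j + g′ j) m ≈ altConv f g m + altConv f g′ m
  altConv-+ʳ zero f g g′ = distribˡ _ _ _
  altConv-+ʳ (suc m) f g g′ = trans (+-cong (distribˡ _ _ _)
    (trans (-‿cong (altConv-+ʳ m f (g ∘ suc) (g′ ∘ suc))) (sym (-‿+-comm _ _)))) (interchange _ _ _ _)

  altConv-*ˡ : ∀ m k f g → altConv (λ r → k * f r) g m ≈ k * altConv f g m
  altConv-*ˡ zero k f g = *-assoc _ _ _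
  altConv-*ˡ (suc m) k f g = trans (+-cong (*-assoc _ _ _)
    (trans (-‿cong (altConv-*ˡ m k f (g ∘ suc))) (-‿distribʳ-* k _))) (sym (distribˡ k _ _))

  altConv-*ʳ : ∀ m k f g → altConv f (λ j → k * g j) m ≈ k * altConv f g m
  altConv-*ʳ zero k f g = x*yz≈y*xz _ _ _
  altConv-*ʳ (suc m) k f g = trans (+-cong (x*yz≈y*xz _ _ _)
    (trans (-‿cong (altConv-*ʳ m k f (g ∘ suc))) (-‿distribʳ-* k _))) (sym (distribˡ k _ _))

  altConv-zeroʳ : ∀ m f {g} → (∀ j → g j ≈ 0#) → altConv f g m ≈ 0#
  altConv-zeroʳ zero f g≈0 = trans (*-congˡ (g≈0 0)) (zeroʳ _)
  altConv-zeroʳ (suc m) f g≈0 = trans (+-cong (trans (*-congˡ (g≈0 0)) (zeroʳ _))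
    (trans (-‿cong (altConv-zeroʳ m f (g≈0 ∘ suc))) -0#≈0#)) (+-identityʳ 0#)

  altConv-∑ʳ : ∀ N m f (g : ℕ → ℕ → Carrier) →
               altConv f (λ j → ∑[ i < N ] g i j) m ≈ ∑[ i < N ] altConv f (g i) m
  altConv-∑ʳ zero m f g = altConv-zeroʳ m f (λ _ → refl)
  altConv-∑ʳ (suc N) m f g = trans (altConv-+ʳ m f _ _) (+-congʳ (altConv-∑ʳ N m f g))

  altConv-unitʳ : ∀ m f {g} → g 0 ≈ 1# → (∀ j → g (suc j) ≈ 0#) → altConv f g m ≈ f m
  altConv-unitʳ zero f g0≈1 _ = trans (*-congˡ g0≈1) (*-identityʳ _)
  altConv-unitʳ (suc m) f g0≈1 g≈0 = trans (+-cong (trans (*-congˡ g0≈1) (*-identityʳ _))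
    (trans (-‿cong (altConv-zeroʳ m f g≈0)) -0#≈0#)) (+-identityʳ _)

  altConv-shiftˡ : ∀ m f g → altConv (shift f) g (suc m) ≈ altConv f g m
  altConv-shiftˡ zero f g = trans (+-congˡ (trans (-‿cong (zeroˡ _)) -0#≈0#)) (+-identityʳ _)
  altConv-shiftˡ (suc m) f g = +-congˡ (-‿cong (altConv-shiftˡ m f (g ∘ suc)))

  altConv-shift-cancel : ∀ m f g → altConv f (shift g) m + altConv (shift f) g m ≈ 0#
  altConv-shift-cancel zero f g = trans (+-cong (zeroʳ _) (zeroˡ _)) (+-identityʳ 0#)
  altConv-shift-cancel (suc m) f g = begin
    (f (suc m) * 0# + - altConv f g m) + altConv (shift f) g (suc m)
      ≈⟨ +-cong (trans (+-congʳ (zeroʳ _)) (+-identityˡ _)) (altConv-shiftˡ m f g) ⟩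
    - altConv f g m + altConv f g m
      ≈⟨ -‿inverseˡ _ ⟩
    0# ∎

  -- Multiplying F(t) by 1 + x t and dividing G(-t) by the same factor leaves F(t) G(-t) unchanged.
  altConv-invariant : ∀ m x {f f′ g g′} → (∀ r → f′ r ≈ f r + x * shift f r) →
                      (∀ j → g′ j ≈ g j + x * shift g′ j) → altConv f′ g′ m ≈ altConv f g m
  altConv-invariant m x {f} {f′} {g} {g′} f′≈ g′≈ = begin
    altConv f′ g′ m
      ≈⟨ altConv-cong m f′≈ (λ _ → refl) ⟩
    altConv (λ r → f r + x * shift f r) g′ m
      ≈⟨ trans (altConv-+ˡ m _ _ _) (+-congˡ (altConv-*ˡ m x _ _)) ⟩
    altConv f g′ m + x * altConv (shift f) g′ m
      ≈⟨ +-congʳ (trans (altConv-cong m (λ _ → refl) g′≈)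
                        (trans (altConv-+ʳ m _ _ _) (+-congˡ (altConv-*ʳ m x _ _)))) ⟩
    (altConv f g m + x * altConv f (shift g′) m) + x * altConv (shift f) g′ m
      ≈⟨ +-assoc _ _ _ ⟩
    altConv f g m + (x * altConv f (shift g′) m + x * altConv (shift f) g′ m)
      ≈⟨ +-congˡ (trans (sym (distribˡ x _ _)) (trans (*-congˡ (altConv-shift-cancel m f g′)) (zeroʳ x))) ⟩
    altConv f g m + 0#
      ≈⟨ +-identityʳ _ ⟩
    altConv f g m ∎

module SymmetricPolynomials {c ℓ} (R : CommutativeRing c ℓ) (X : ℕ → CommutativeRing.Carrier R) where
  open CommutativeRing R hiding (zero)
  open FiniteSums R
  open AlternatingConvolution R
  open import Relation.Binary.Reasoning.Setoid setoid
  open import Algebra.Solver.Ring.NaturalCoefficients.Default commutativeSemiring using (solve; _:=_; _:+_; _:*_; con)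
  open import Algebra.Properties.CommutativeSemigroup *-commutativeSemigroup
    using () renaming (x∙yz≈y∙xz to x*yz≈y*xz)

  -- e N r α = e_r(X α, …, X (N - 1)) and h N j c = h_j(X c, …, X (N - 1)), expanded along the smallest index.
  e : ℕ → ℕ → ℕ → Carrier
  e N zero α = 1#
  e N (suc r) α = ∑[ a < N ] (𝟙[ α ≤ᵇ a ] (X a) * e N r (suc a))

  h : ℕ → ℕ → ℕ → Carrier
  h N zero c = 1#
  h N (suc j) c = ∑[ a < N ] (𝟙[ c ≤ᵇ a ] (X a) * h N j a)

  e-vanish : ∀ {N α} r → N ≤ α → e N (suc r) α ≈ 0#
  e-vanish {N} r N≤α = ∑-zero N λ a a<N → trans (*-congʳ (𝟙-≤ᵇ-false _ (<-≤-trans a<N N≤α))) (zeroˡ _)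

  h-vanish : ∀ c j → h c (suc j) c ≈ 0#
  h-vanish c j = ∑-zero c λ a a<c → trans (*-congʳ (𝟙-≤ᵇ-false _ a<c)) (zeroˡ _)

  e-extend : ∀ {N α} → α ≤ N → ∀ r → e (suc N) r α ≈ e N r α + X N * shift (λ r → e N r α) r
  e-extend α≤N zero = sym (trans (+-congˡ (zeroʳ _)) (+-identityʳ _))
  e-extend {N} {α} α≤N (suc r) = begin
    ∑[ a < N ] (w a * e (suc N) r (suc a)) + w N * e (suc N) r (suc N)
      ≈⟨ +-cong (∑-cong N λ a a<N → *-congˡ (e-extend a<N r)) (*-congʳ (𝟙-≤ᵇ-true (X N) α≤N)) ⟩
    ∑[ a < N ] (w a * (e N r (suc a) + X N * shift (λ r → e N r (suc a)) r)) + X N * e (suc N) r (suc N)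
      ≈⟨ +-congʳ (∑-linear N w _ _ (X N)) ⟩
    (e N (suc r) α + X N * ∑[ a < N ] (w a * shift (λ r → e N r (suc a)) r)) + X N * e (suc N) r (suc N)
      ≈⟨ trans (+-assoc _ _ _) (+-congˡ (sym (distribˡ (X N) _ _))) ⟩
    e N (suc r) α + X N * (∑[ a < N ] (w a * shift (λ r → e N r (suc a)) r) + e (suc N) r (suc N))
      ≈⟨ +-congˡ (*-congˡ (remainder r)) ⟩
    e N (suc r) α + X N * e N r α ∎
    where
    w : ℕ → Carrier
    w a = 𝟙[ α ≤ᵇ a ] (X a)
    remainder : ∀ r → ∑[ a < N ] (w a * shift (λ r → e N r (suc a)) r) + e (suc N) r (suc N) ≈ e N r α
    remainder zero = trans (+-congʳ (∑-zero N λ a _ → zeroʳ _)) (+-identityˡ 1#)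
    remainder (suc r) = trans (+-congˡ (e-vanish {suc N} r ≤-refl)) (+-identityʳ _)

  h-extend : ∀ {N c} → c ≤ N → ∀ j → h (suc N) j c ≈ h N j c + X N * shift (λ j → h (suc N) j c) j
  h-extend c≤N zero = sym (trans (+-congˡ (zeroʳ _)) (+-identityʳ _))
  h-extend {N} {c} c≤N (suc j) = begin
    ∑[ a < N ] (w a * h (suc N) j a) + w N * h (suc N) j N
      ≈⟨ +-cong (∑-cong N λ a a<N → *-congˡ (h-extend (<⇒≤ a<N) j)) (*-congʳ (𝟙-≤ᵇ-true (X N) c≤N)) ⟩
    ∑[ a < N ] (w a * (h N j a + X N * shift (λ j → h (suc N) j a) j)) + X N * h (suc N) j N
      ≈⟨ +-congʳ (∑-linear N w _ _ (X N)) ⟩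
    (h N (suc j) c + X N * ∑[ a < N ] (w a * shift (λ j → h (suc N) j a) j)) + X N * h (suc N) j N
      ≈⟨ trans (+-assoc _ _ _) (+-congˡ (sym (distribˡ (X N) _ _))) ⟩
    h N (suc j) c + X N * (∑[ a < N ] (w a * shift (λ j → h (suc N) j a) j) + h (suc N) j N)
      ≈⟨ +-congˡ (*-congˡ (remainder j)) ⟩
    h N (suc j) c + X N * h (suc N) j c ∎
    where
    w : ℕ → Carrier
    w a = 𝟙[ c ≤ᵇ a ] (X a)
    top : ∀ j → h (suc N) (suc j) N ≈ X N * h (suc N) j N
    top j = trans (+-cong (∑-zero N λ a a<N → trans (*-congʳ (𝟙-≤ᵇ-false _ a<N)) (zeroˡ _))
                          (*-congʳ (𝟙-≤ᵇ-true (X N) (≤-refl {N})))) (+-identityˡ _)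
    remainder : ∀ j → ∑[ a < N ] (w a * shift (λ j → h (suc N) j a) j) + h (suc N) j N ≈ h (suc N) j c
    remainder zero = trans (+-congʳ (∑-zero N λ a _ → zeroʳ _)) (+-identityˡ 1#)
    remainder (suc j) = +-congˡ (trans (top j) (*-congʳ (sym (𝟙-≤ᵇ-true (X N) c≤N))))

  altConv-e-h : ∀ {c N} → c ≤ N → ∀ m → altConv (λ r → e N r 0) (λ j → h N j c) m ≈ e c m 0
  altConv-e-h c≤N = go (≤⇒≤′ c≤N)
    where
    go : ∀ {c N} → c ≤′ N → ∀ m → altConv (λ r → e N r 0) (λ j → h N j c) m ≈ e c m 0
    go {c} ≤′-refl m = altConv-unitʳ m _ refl (h-vanish c)
    go (≤′-step c≤′N) m =
      trans (altConv-invariant m _ (e-extend z≤n) (h-extend (≤′⇒≤ c≤′N))) (go c≤′N m)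

  topCoeff : ℕ → ℕ → ℕ → ℕ → Carrier
  topCoeff α β a b = 𝟙[ a ≤ᵇ b ] (𝟙[ α ≤ᵇ a ] (𝟙[ β ≤ᵇ b ] (X a * X b)))

  topRowSum : ℕ → ℕ → ℕ → (ℕ → ℕ → Carrier) → Carrier
  topRowSum N α β F = ∑[ a < N ] ∑[ b < N ] (topCoeff α β a b * F a b)

  -- twoColumn N q d α β sums X^T over the semistandard tableaux T of shape (2^q, 1^d) with entries
  -- below N, first column starting at α or later and second column at β or later; (a, b) is the top row.
  twoColumn : ℕ → ℕ → ℕ → ℕ → ℕ → Carrier
  twoColumn N zero d α β = e N d α
  twoColumn N (suc q) d α β = topRowSum N α β (λ a b → twoColumn N q d (suc a) (suc b))

  -- Each tableau is also weighted by w at the top of its second column (by w N if that column is empty).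
  twoColumnʷ : ℕ → ℕ → ℕ → ℕ → ℕ → (ℕ → Carrier) → Carrier
  twoColumnʷ N zero d α β w = e N d α * w N
  twoColumnʷ N (suc q) d α β w = topRowSum N α β (λ a b → twoColumn N q d (suc a) (suc b) * w b)

  topRowSum-cong : ∀ N α β {F G} → (∀ a b → a < N → b < N → F a b ≈ G a b) →
                   topRowSum N α β F ≈ topRowSum N α β G
  topRowSum-cong N α β F≈G = ∑-cong N λ a a<N → ∑-cong N λ b b<N → *-congˡ (F≈G a b a<N b<N)

  topRowSum-zero : ∀ N α β {F} → (∀ a b → F a b ≈ 0#) → topRowSum N α β F ≈ 0#
  topRowSum-zero N α β F≈0 = ∑-zero N λ a _ → ∑-zero N λ b _ → trans (*-congˡ (F≈0 a b)) (zeroʳ _)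

  topRowSum-+ : ∀ N α β F G → topRowSum N α β (λ a b → F a b + G a b) ≈ topRowSum N α β F + topRowSum N α β G
  topRowSum-+ N α β F G = trans (∑-cong N λ a _ → trans (∑-cong N λ b _ → distribˡ _ _ _) (∑-distrib-+ N _ _))
                                (∑-distrib-+ N _ _)

  topRowSum-* : ∀ N α β k F → topRowSum N α β (λ a b → k * F a b) ≈ k * topRowSum N α β F
  topRowSum-* N α β k F = sym (trans (*-distribˡ-∑ N k _) (∑-cong N λ a _ →
    trans (*-distribˡ-∑ N k _) (∑-cong N λ b _ → sym (x*yz≈y*xz _ k _))))

  topRowSum-extend : ∀ {N β} α F → β ≤ N →
    topRowSum (suc N) α β F ≈ topRowSum N α β F + X N * ∑[ a < suc N ] (𝟙[ α ≤ᵇ a ] (X a) * F a N)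
  topRowSum-extend {N} {β} α F β≤N = begin
    ∑[ a < N ] (∑[ b < N ] T a b + T a N) + (∑[ b < N ] T N b + T N N)
      ≈⟨ +-cong (∑-distrib-+ N _ _)
                (+-congʳ (∑-zero N λ b b<N → trans (*-congʳ (𝟙-≤ᵇ-false _ b<N)) (zeroˡ _))) ⟩
    (topRowSum N α β F + ∑[ a < N ] T a N) + (0# + T N N)
      ≈⟨ trans (+-assoc _ _ _) (+-congˡ (+-congˡ (+-identityˡ _))) ⟩
    topRowSum N α β F + ∑[ a < suc N ] T a N
      ≈⟨ +-congˡ (trans (∑-cong (suc N) λ a a<1+N → lastColumn a (m<1+n⇒m≤n a<1+N))
                        (sym (*-distribˡ-∑ (suc N) (X N) _))) ⟩
    topRowSum N α β F + X N * ∑[ a < suc N ] (𝟙[ α ≤ᵇ a ] (X a) * F a N) ∎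
    where
    T : ℕ → ℕ → Carrier
    T a b = topCoeff α β a b * F a b
    lastColumn : ∀ a → a ≤ N → T a N ≈ X N * (𝟙[ α ≤ᵇ a ] (X a) * F a N)
    lastColumn a a≤N = begin
      𝟙[ a ≤ᵇ N ] (𝟙[ α ≤ᵇ a ] (𝟙[ β ≤ᵇ N ] (X a * X N))) * F a N
        ≈⟨ *-congʳ (trans (𝟙-≤ᵇ-true _ a≤N) (𝟙-cong (α ≤ᵇ a) (𝟙-≤ᵇ-true _ β≤N))) ⟩
      𝟙[ α ≤ᵇ a ] (X a * X N) * F a N
        ≈⟨ *-congʳ (𝟙-*ʳ (α ≤ᵇ a) (X a) (X N)) ⟩
      𝟙[ α ≤ᵇ a ] (X a) * X N * F a N
        ≈⟨ trans (*-congʳ (*-comm _ _)) (*-assoc _ _ _) ⟩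
      X N * (𝟙[ α ≤ᵇ a ] (X a) * F a N) ∎

  -- Adjoining a new largest variable x to sums F q d over tableaux of shape (2^q, 1^d):
  -- x may end the first column, the second column, or both.
  endsSecond : Carrier → (ℕ → ℕ → Carrier) → ℕ → ℕ → Carrier
  endsSecond x F zero d = 0#
  endsSecond x F (suc q) d = x * F q (suc d) + x * x * F q d

  adjoin : Carrier → (ℕ → ℕ → Carrier) → ℕ → ℕ → Carrier
  adjoin x F q d = F q d + x * shift (F q) d + endsSecond x F q d

  adjoin-cong : ∀ x {F G} q d → (∀ q d → F q d ≈ G q d) → adjoin x F q d ≈ adjoin x G q d
  adjoin-cong x zero d F≈G = +-congʳ (+-cong (F≈G 0 d) (*-congˡ (shift-cong d (F≈G 0))))
  adjoin-cong x (suc q) d F≈G = +-cong (+-cong (F≈G (suc q) d) (*-congˡ (shift-cong d (F≈G (suc q)))))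
    (+-cong (*-congˡ (F≈G q (suc d))) (*-congˡ (F≈G q d)))

  topRowSum-adjoin : ∀ N α β x (w : ℕ → Carrier) (F : ℕ → ℕ → ℕ → ℕ → Carrier) q d →
    topRowSum N α β (λ a b → adjoin x (F a b) q d * w b)
      ≈ adjoin x (λ q d → topRowSum N α β (λ a b → F a b q d * w b)) q d
  topRowSum-adjoin N α β x w F q d =
    trans (Φ-+ _ _) (+-cong (trans (Φ-+ _ _) (+-congˡ (trans (Φ-* x _) (*-congˡ (Φ-shift d))))) (Φ-ends q))
    where
    Φ : (ℕ → ℕ → Carrier) → Carrier
    Φ G = topRowSum N α β (λ a b → G a b * w b)
    Φ-+ : ∀ G H → Φ (λ a b → G a b + H a b) ≈ Φ G + Φ H
    Φ-+ G H = trans (topRowSum-cong N α β λ a b _ _ → distribʳ (w b) _ _) (topRowSum-+ N α β _ _)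
    Φ-* : ∀ k G → Φ (λ a b → k * G a b) ≈ k * Φ G
    Φ-* k G = trans (topRowSum-cong N α β λ a b _ _ → *-assoc k _ _) (topRowSum-* N α β k _)
    Φ-shift : ∀ d → Φ (λ a b → shift (F a b q) d) ≈ shift (λ d → Φ (λ a b → F a b q d)) d
    Φ-shift zero = topRowSum-zero N α β λ a b → zeroˡ _
    Φ-shift (suc d) = refl
    Φ-ends : ∀ q → Φ (λ a b → endsSecond x (F a b) q d) ≈ endsSecond x (λ q d → Φ (λ a b → F a b q d)) q d
    Φ-ends zero = topRowSum-zero N α β λ a b → zeroˡ _
    Φ-ends (suc q) = trans (Φ-+ _ _) (+-cong (Φ-* x _) (Φ-* (x * x) _))

  twoColumn-vanish : ∀ {N β} q d α → N ≤ β → twoColumn N (suc q) d α β ≈ 0#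
  twoColumn-vanish {N} {β} q d α N≤β =
    ∑-zero N λ a _ → ∑-zero N λ b b<N → trans (*-congʳ (topCoeff≈0 a b b<N)) (zeroˡ _)
    where
    topCoeff≈0 : ∀ a b → b < N → topCoeff α β a b ≈ 0#
    topCoeff≈0 a b b<N = trans (𝟙-cong (a ≤ᵇ b) (trans (𝟙-cong (α ≤ᵇ a) (𝟙-≤ᵇ-false _ (<-≤-trans b<N N≤β)))
                                                        (𝟙-zero (α ≤ᵇ a))))
                               (𝟙-zero (a ≤ᵇ b))

  -- the tableaux whose second column starts with the new entry N
  twoColumnʷ-boundary : ∀ q {N α β} d w → α ≤ N →
    endsSecond (X N) (λ q d → twoColumnʷ N (suc q) d α β w) q d
      + X N * ∑[ a < suc N ] (𝟙[ α ≤ᵇ a ] (X a) * (twoColumn (suc N) q d (suc a) (suc N) * w N))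
      ≈ X N * twoColumnʷ N q (suc d) α β w + X N * X N * twoColumnʷ N q d α β w
  twoColumnʷ-boundary zero {N} {α} d w α≤N = begin
    0# + X N * ∑[ a < suc N ] (𝟙[ α ≤ᵇ a ] (X a) * (e (suc N) d (suc a) * w N))
      ≈⟨ +-congˡ (*-congˡ (trans (∑-cong (suc N) λ a _ → sym (*-assoc _ _ _))
                                 (sym (*-distribʳ-∑ (suc N) (w N) _)))) ⟩
    0# + X N * (e (suc N) (suc d) α * w N)
      ≈⟨ +-congˡ (*-congˡ (*-congʳ (e-extend α≤N (suc d)))) ⟩
    0# + X N * ((e N (suc d) α + X N * e N d α) * w N)
      ≈⟨ expand (e N (suc d) α) (e N d α) (w N) (X N) ⟩
    X N * (e N (suc d) α * w N) + X N * X N * (e N d α * w N) ∎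
    where
    expand : ∀ A B W x → 0# + x * ((A + x * B) * W) ≈ x * (A * W) + x * x * (B * W)
    expand = solve 4 (λ A B W x → con 0 :+ x :* ((A :+ x :* B) :* W) := x :* (A :* W) :+ x :* x :* (B :* W)) refl
  twoColumnʷ-boundary (suc q) {N} {α} d w α≤N =
    trans (+-congˡ (trans (*-congˡ (∑-zero (suc N) λ a _ → vanishing a)) (zeroʳ (X N)))) (+-identityʳ _)
    where
    vanishing : ∀ a → 𝟙[ α ≤ᵇ a ] (X a) * (twoColumn (suc N) (suc q) d (suc a) (suc N) * w N) ≈ 0#
    vanishing a = trans (*-congˡ (trans (*-congʳ (twoColumn-vanish {suc N} q d (suc a) ≤-refl)) (zeroˡ _))) (zeroʳ _)

  twoColumnʷ-extend : ∀ q →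
    (∀ {N d α β} → α ≤ N → β ≤ N →
       twoColumn (suc N) q d α β ≈ adjoin (X N) (λ q d → twoColumn N q d α β) q d) →
    ∀ {N α β} d w → α ≤ N → β ≤ N →
    twoColumnʷ (suc N) (suc q) d α β w ≈ adjoin (X N) (λ q d → twoColumnʷ N q d α β w) (suc q) d
  twoColumnʷ-extend q extend {N} {α} {β} d w α≤N β≤N = begin
    twoColumnʷ (suc N) (suc q) d α β w
      ≈⟨ topRowSum-extend α _ β≤N ⟩
    topRowSum N α β (λ a b → twoColumn (suc N) q d (suc a) (suc b) * w b) + X N * lastColumn
      ≈⟨ +-congʳ (topRowSum-cong N α β λ a b a<N b<N → *-congʳ (extend a<N b<N)) ⟩
    topRowSum N α β (λ a b → adjoin (X N) (λ q d → twoColumn N q d (suc a) (suc b)) q d * w b) + X N * lastColumn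
      ≈⟨ +-congʳ (topRowSum-adjoin N α β (X N) w _ q d) ⟩
    adjoin (X N) (λ q d → W (suc q) d) q d + X N * lastColumn
      ≈⟨ +-assoc _ _ _ ⟩
    (W (suc q) d + X N * shift (W (suc q)) d) + (endsSecond (X N) (λ q d → W (suc q) d) q d + X N * lastColumn)
      ≈⟨ +-congˡ (twoColumnʷ-boundary q d w α≤N) ⟩
    adjoin (X N) W (suc q) d ∎
    where
    W : ℕ → ℕ → Carrier
    W q d = twoColumnʷ N q d α β w
    lastColumn : Carrier
    lastColumn = ∑[ a < suc N ] (𝟙[ α ≤ᵇ a ] (X a) * (twoColumn (suc N) q d (suc a) (suc N) * w N))

  twoColumnʷ-one : ∀ N q d α β → twoColumnʷ N q d α β (λ _ → 1#) ≈ twoColumn N q d α β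
  twoColumnʷ-one N zero d α β = *-identityʳ _
  twoColumnʷ-one N (suc q) d α β = topRowSum-cong N α β λ a b _ _ → *-identityʳ _

  twoColumn-extend : ∀ q {N d α β} → α ≤ N → β ≤ N →
    twoColumn (suc N) q d α β ≈ adjoin (X N) (λ q d → twoColumn N q d α β) q d
  twoColumn-extend zero {d = d} α≤N β≤N = trans (e-extend α≤N d) (sym (+-identityʳ _))
  twoColumn-extend (suc q) {N} {d} {α} {β} α≤N β≤N = begin
    twoColumn (suc N) (suc q) d α β
      ≈⟨ sym (twoColumnʷ-one (suc N) (suc q) d α β) ⟩
    twoColumnʷ (suc N) (suc q) d α β (λ _ → 1#)
      ≈⟨ twoColumnʷ-extend q (twoColumn-extend q) d _ α≤N β≤N ⟩
    adjoin (X N) (λ q d → twoColumnʷ N q d α β (λ _ → 1#)) (suc q) d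
      ≈⟨ adjoin-cong (X N) (suc q) d (λ q d → twoColumnʷ-one N q d α β) ⟩
    adjoin (X N) (λ q d → twoColumn N q d α β) (suc q) d ∎

  -- For q = 0 the family is a product of two columns of lengths d and m, and x may end either or both.
  endsThird : Carrier → (ℕ → ℕ → ℕ → Carrier) → ℕ → ℕ → ℕ → Carrier
  endsThird x F zero d m = x * shift (F 0 d) m + x * x * shift (λ d → shift (F 0 d) m) d
  endsThird x F (suc q) d m = 0#

  adjoin₃ : Carrier → (ℕ → ℕ → ℕ → Carrier) → ℕ → ℕ → ℕ → Carrier
  adjoin₃ x F q d m = adjoin x (λ q d → F q d m) q d + endsThird x F q d m

  adjoin₃-cong : ∀ x {F G} q d m → (∀ q d m → F q d m ≈ G q d m) → adjoin₃ x F q d m ≈ adjoin₃ x G q d m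
  adjoin₃-cong x zero d m F≈G = +-cong (adjoin-cong x 0 d λ q d → F≈G q d m)
    (+-cong (*-congˡ (shift-cong m (F≈G 0 d))) (*-congˡ (shift-cong d λ d → shift-cong m (F≈G 0 d))))
  adjoin₃-cong x (suc q) d m F≈G = +-congʳ (adjoin-cong x (suc q) d λ q d → F≈G q d m)

  twoColumnᵉ : ℕ → ℕ → ℕ → ℕ → Carrier
  twoColumnᵉ N q d m = twoColumnʷ N q d 0 0 (λ b → e b m 0)

  -- pieri N q d m = ∑_{i ≤ min d m} s_(2^(q+i), 1^(d+m-2i))(X 0, …, X (N - 1)), the two-column part
  -- of the Pieri expansion of s_(2^q, 1^d) e_m.
  mutual
    pieri : ℕ → ℕ → ℕ → ℕ → Carrier
    pieri N q d m = twoColumn N q (d ℕ.+ m) 0 0 + pieriTail N q d m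

    pieriTail : ℕ → ℕ → ℕ → ℕ → Carrier
    pieriTail N q (suc d) (suc m) = pieri N (suc q) d m
    pieriTail N q _ _ = 0#

  twoColumnᵉ-extend : ∀ {N} q d m → twoColumnᵉ (suc N) q d m ≈ adjoin₃ (X N) (twoColumnᵉ N) q d m
  twoColumnᵉ-extend {N} zero d m = begin
    e (suc N) d 0 * e (suc N) m 0
      ≈⟨ *-cong (e-extend z≤n d) (e-extend z≤n m) ⟩
    (e N d 0 + X N * shift E d) * (e N m 0 + X N * shift E m)
      ≈⟨ expand (e N d 0) (shift E d) (e N m 0) (shift E m) (X N) ⟩
    ((e N d 0 * e N m 0 + X N * (shift E d * e N m 0)) + 0#)
      + (X N * (e N d 0 * shift E m) + X N * X N * (shift E d * shift E m))
      ≈⟨ sym (+-cong (+-congʳ (+-congˡ (*-congˡ (shift-*ʳ E (e N m 0) d))))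
                     (+-cong (*-congˡ (shift-*ˡ (e N d 0) E m))
                             (*-congˡ (trans (shift-cong d λ d → shift-*ˡ (e N d 0) E m) (shift-*ʳ E (shift E m) d))))) ⟩
    adjoin₃ (X N) (twoColumnᵉ N) zero d m ∎
    where
    E : ℕ → Carrier
    E r = e N r 0
    expand : ∀ A B C D x → (A + x * B) * (C + x * D) ≈ ((A * C + x * (B * C)) + 0#) + (x * (A * D) + x * x * (B * D))
    expand = solve 5 (λ A B C D x → (A :+ x :* B) :* (C :+ x :* D)
                       := ((A :* C :+ x :* (B :* C)) :+ con 0) :+ (x :* (A :* D) :+ x :* x :* (B :* D))) refl
  twoColumnᵉ-extend (suc q) d m =
    trans (twoColumnʷ-extend q (twoColumn-extend q) d _ z≤n z≤n) (sym (+-identityʳ _))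

  pieriTail-zeroʳ : ∀ N q d → pieriTail N q d 0 ≈ 0#
  pieriTail-zeroʳ N q zero = refl
  pieriTail-zeroʳ N q (suc d) = refl

  pieriTail-sucʳ : ∀ N q d m → pieriTail N q d (suc m) ≈ shift (λ d → pieri N (suc q) d m) d
  pieriTail-sucʳ N q zero m = refl
  pieriTail-sucʳ N q (suc d) m = refl

  pieriTail-one : ∀ N q m → pieriTail N q 1 m ≈ shift (λ m → twoColumn N (suc q) m 0 0) m
  pieriTail-one N q zero = refl
  pieriTail-one N q (suc m) = +-identityʳ _

  module _ (N : ℕ) where
    private
      x : Carrier
      x = X N
      P P′ : ℕ → ℕ → Carrier
      P q e = twoColumn N q e 0 0
      P′ q e = twoColumn (suc N) q e 0 0
      D : ℕ → ℕ → ℕ → Carrier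
      D = pieri N
      P′≈ : ∀ q e → P′ q e ≈ adjoin x P q e
      P′≈ q e = twoColumn-extend q z≤n z≤n

    pieri-extend-zeroˡ : ∀ q m → pieri (suc N) q 0 m ≈ adjoin₃ (X N) (pieri N) q 0 m
    pieri-extend-zeroˡ zero m = begin
      P′ 0 m + 0#
        ≈⟨ +-congʳ (P′≈ 0 m) ⟩
      (P 0 m + x * shift (P 0) m + 0#) + 0#
        ≈⟨ rearrange (P 0 m) (shift (P 0) m) x ⟩
      ((P 0 m + 0#) + x * 0# + 0#) + (x * shift (P 0) m + x * x * 0#)
        ≈⟨ +-congˡ (+-congʳ (*-congˡ (shift-cong m λ _ → sym (+-identityʳ _)))) ⟩
      adjoin₃ x D 0 0 m ∎
      where
      rearrange : ∀ A S x → (A + x * S + 0#) + 0# ≈ ((A + 0#) + x * 0# + 0#) + (x * S + x * x * 0#)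
      rearrange = solve 3 (λ A S x → (A :+ x :* S :+ con 0) :+ con 0
                           := ((A :+ con 0) :+ x :* con 0 :+ con 0) :+ (x :* S :+ x :* x :* con 0)) refl
    pieri-extend-zeroˡ (suc q) m = begin
      P′ (suc q) m + 0#
        ≈⟨ +-congʳ (P′≈ (suc q) m) ⟩
      (P (suc q) m + x * shift (P (suc q)) m + (x * P q (suc m) + x * x * P q m)) + 0#
        ≈⟨ rearrange (P (suc q) m) (shift (P (suc q)) m) (P q (suc m)) (P q m) x ⟩
      ((P (suc q) m + 0#) + x * 0# + (x * (P q (suc m) + shift (P (suc q)) m) + x * x * (P q m + 0#))) + 0#
        ≈⟨ +-congʳ (+-congˡ (+-congʳ (*-congˡ (+-congˡ (sym (pieriTail-one N q m)))))) ⟩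
      adjoin₃ x D (suc q) 0 m ∎
      where
      rearrange : ∀ A S B C x → (A + x * S + (x * B + x * x * C)) + 0#
                                ≈ ((A + 0#) + x * 0# + (x * (B + S) + x * x * (C + 0#))) + 0#
      rearrange = solve 5 (λ A S B C x → (A :+ x :* S :+ (x :* B :+ x :* x :* C)) :+ con 0
                           := ((A :+ con 0) :+ x :* con 0 :+ (x :* (B :+ S) :+ x :* x :* (C :+ con 0))) :+ con 0) refl
    pieri-extend-zeroʳ : ∀ q d → pieri (suc N) q (suc d) 0 ≈ adjoin₃ (X N) (pieri N) q (suc d) 0
    pieri-extend-zeroʳ zero d = begin
      P′ 0 s + 0#
        ≈⟨ +-congʳ (P′≈ 0 s) ⟩
      (P 0 s + x * P 0 (d ℕ.+ 0) + 0#) + 0#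
        ≈⟨ rearrange (P 0 s) (P 0 (d ℕ.+ 0)) x ⟩
      ((P 0 s + 0#) + x * (P 0 (d ℕ.+ 0) + 0#) + 0#) + (x * 0# + x * x * 0#)
        ≈⟨ +-congʳ (+-congʳ (+-congˡ (*-congˡ (+-congˡ (sym (pieriTail-zeroʳ N 0 d)))))) ⟩
      adjoin₃ x D 0 (suc d) 0 ∎
      where
      s : ℕ
      s = suc d ℕ.+ 0
      rearrange : ∀ A B x → (A + x * B + 0#) + 0# ≈ ((A + 0#) + x * (B + 0#) + 0#) + (x * 0# + x * x * 0#)
      rearrange = solve 3 (λ A B x → (A :+ x :* B :+ con 0) :+ con 0
                           := ((A :+ con 0) :+ x :* (B :+ con 0) :+ con 0) :+ (x :* con 0 :+ x :* x :* con 0)) refl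
    pieri-extend-zeroʳ (suc q) d = begin
      P′ (suc q) s + 0#
        ≈⟨ +-congʳ (P′≈ (suc q) s) ⟩
      (P (suc q) s + x * P (suc q) (d ℕ.+ 0) + (x * P q (suc s) + x * x * P q s)) + 0#
        ≈⟨ rearrange (P (suc q) s) (P (suc q) (d ℕ.+ 0)) (P q (suc s)) (P q s) x ⟩
      ((P (suc q) s + 0#) + x * (P (suc q) (d ℕ.+ 0) + 0#) + (x * (P q (suc s) + 0#) + x * x * (P q s + 0#))) + 0#
        ≈⟨ +-congʳ (+-congʳ (+-congˡ (*-congˡ (+-congˡ (sym (pieriTail-zeroʳ N (suc q) d)))))) ⟩
      adjoin₃ x D (suc q) (suc d) 0 ∎
      where
      s : ℕ
      s = suc d ℕ.+ 0
      rearrange : ∀ A B C E x → (A + x * B + (x * C + x * x * E)) + 0#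
                                ≈ ((A + 0#) + x * (B + 0#) + (x * (C + 0#) + x * x * (E + 0#))) + 0#
      rearrange = solve 5 (λ A B C E x → (A :+ x :* B :+ (x :* C :+ x :* x :* E)) :+ con 0
                           := ((A :+ con 0) :+ x :* (B :+ con 0) :+ (x :* (C :+ con 0) :+ x :* x :* (E :+ con 0))) :+ con 0) refl
    pieri-extend : ∀ q d m → pieri (suc N) q d m ≈ adjoin₃ (X N) (pieri N) q d m
    pieri-extend q zero m = pieri-extend-zeroˡ q m
    pieri-extend q (suc d) zero = pieri-extend-zeroʳ q d
    pieri-extend zero (suc d) (suc m) = begin
      P′ 0 s + pieri (suc N) 1 d m
        ≈⟨ +-cong (P′≈ 0 s) (pieri-extend 1 d m) ⟩
      (P 0 s + x * P 0 (d ℕ.+ suc m) + 0#)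
        + ((D 1 d m + x * shift (λ d → D 1 d m) d + (x * D 0 (suc d) m + x * x * D 0 d m)) + 0#)
        ≈⟨ rearrange (P 0 s) (P 0 (d ℕ.+ suc m)) (D 1 d m) (shift (λ d → D 1 d m) d) (D 0 (suc d) m) (D 0 d m) x ⟩
      ((P 0 s + D 1 d m) + x * (P 0 (d ℕ.+ suc m) + shift (λ d → D 1 d m) d) + 0#)
        + (x * D 0 (suc d) m + x * x * D 0 d m)
        ≈⟨ +-congʳ (+-congʳ (+-congˡ (*-congˡ (+-congˡ (sym (pieriTail-sucʳ N 0 d m)))))) ⟩
      adjoin₃ x D 0 (suc d) (suc m) ∎
      where
      s : ℕ
      s = suc d ℕ.+ suc m
      rearrange : ∀ A B C T F G x → (A + x * B + 0#) + ((C + x * T + (x * F + x * x * G)) + 0#)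
                                    ≈ ((A + C) + x * (B + T) + 0#) + (x * F + x * x * G)
      rearrange = solve 7 (λ A B C T F G x → (A :+ x :* B :+ con 0) :+ ((C :+ x :* T :+ (x :* F :+ x :* x :* G)) :+ con 0)
                           := ((A :+ C) :+ x :* (B :+ T) :+ con 0) :+ (x :* F :+ x :* x :* G)) refl
    pieri-extend (suc q) (suc d) (suc m) = begin
      P′ (suc q) s + pieri (suc N) (suc (suc q)) d m
        ≈⟨ +-cong (P′≈ (suc q) s) (pieri-extend (suc (suc q)) d m) ⟩
      (P (suc q) s + x * P (suc q) (d ℕ.+ suc m) + (x * P q (suc s) + x * x * P q s))
        + ((D (suc (suc q)) d m + x * shift (λ d → D (suc (suc q)) d m) d
            + (x * D (suc q) (suc d) m + x * x * D (suc q) d m)) + 0#)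
        ≈⟨ rearrange (P (suc q) s) (P (suc q) (d ℕ.+ suc m)) (P q (suc s)) (P q s) (D (suc (suc q)) d m)
                     (shift (λ d → D (suc (suc q)) d m) d) (D (suc q) (suc d) m) (D (suc q) d m) x ⟩
      ((P (suc q) s + D (suc (suc q)) d m) + x * (P (suc q) (d ℕ.+ suc m) + shift (λ d → D (suc (suc q)) d m) d)
        + (x * (P q (suc s) + D (suc q) (suc d) m) + x * x * (P q s + D (suc q) d m))) + 0#
        ≈⟨ +-congʳ (+-congʳ (+-congˡ (*-congˡ (+-congˡ (sym (pieriTail-sucʳ N (suc q) d m)))))) ⟩
      adjoin₃ x D (suc q) (suc d) (suc m) ∎
      where
      s : ℕ
      s = suc d ℕ.+ suc m
      rearrange : ∀ A B C E F T G H x → (A + x * B + (x * C + x * x * E)) + ((F + x * T + (x * G + x * x * H)) + 0#)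
                                        ≈ ((A + F) + x * (B + T) + (x * (C + G) + x * x * (E + H))) + 0#
      rearrange = solve 9 (λ A B C E F T G H x →
                    (A :+ x :* B :+ (x :* C :+ x :* x :* E)) :+ ((F :+ x :* T :+ (x :* G :+ x :* x :* H)) :+ con 0)
                    := ((A :+ F) :+ x :* (B :+ T) :+ (x :* (C :+ G) :+ x :* x :* (E :+ H))) :+ con 0) refl

  pieri-empty : ∀ q d m → pieri 0 (suc q) d m ≈ 0#
  pieri-empty q zero m = +-identityʳ 0#
  pieri-empty q (suc d) zero = +-identityʳ 0#
  pieri-empty q (suc d) (suc m) = trans (+-identityˡ _) (pieri-empty (suc q) d m)

  twoColumnᵉ≈pieri : ∀ N q d m → twoColumnᵉ N q d m ≈ pieri N q d m
  twoColumnᵉ≈pieri zero zero zero zero = trans (*-identityˡ 1#) (sym (+-identityʳ 1#))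
  twoColumnᵉ≈pieri zero zero zero (suc m) = trans (zeroʳ 1#) (sym (+-identityʳ 0#))
  twoColumnᵉ≈pieri zero zero (suc d) zero = trans (zeroˡ 1#) (sym (+-identityʳ 0#))
  twoColumnᵉ≈pieri zero zero (suc d) (suc m) = trans (zeroˡ 0#) (sym (trans (+-identityˡ _) (pieri-empty 0 d m)))
  twoColumnᵉ≈pieri zero (suc q) d m = sym (pieri-empty q d m)
  twoColumnᵉ≈pieri (suc N) q d m = begin
    twoColumnᵉ (suc N) q d m                ≈⟨ twoColumnᵉ-extend q d m ⟩
    adjoin₃ (X N) (twoColumnᵉ N) q d m      ≈⟨ adjoin₃-cong (X N) q d m (twoColumnᵉ≈pieri N) ⟩
    adjoin₃ (X N) (pieri N) q d m           ≈⟨ sym (pieri-extend N q d m) ⟩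
    pieri (suc N) q d m                     ∎

  altConv-twoColumnʷ : ∀ N q d α β f (w : ℕ → ℕ → Carrier) m →
    altConv f (λ j → twoColumnʷ N (suc q) d α β (w j)) m
      ≈ twoColumnʷ N (suc q) d α β (λ b → altConv f (λ j → w j b) m)
  altConv-twoColumnʷ N q d α β f w m =
    trans (altConv-∑ʳ N m f _) (∑-cong N λ a _ → trans (altConv-∑ʳ N m f _) (∑-cong N λ b _ →
      trans (altConv-*ʳ m _ f _) (*-congˡ (altConv-*ʳ m _ f _))))

  altConv-e-twoColumnʷ-h : ∀ N q m →
    altConv (λ r → e N r 0) (λ j → twoColumnʷ N (suc q) 0 0 0 (h N j)) m ≈ twoColumn N (suc q) m 0 0
  altConv-e-twoColumnʷ-h N q m = begin
    altConv (λ r → e N r 0) (λ j → twoColumnʷ N (suc q) 0 0 0 (h N j)) m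
      ≈⟨ altConv-twoColumnʷ N q 0 0 0 _ (h N) m ⟩
    twoColumnʷ N (suc q) 0 0 0 (λ b → altConv (λ r → e N r 0) (λ j → h N j b) m)
      ≈⟨ topRowSum-cong N 0 0 (λ a b _ b<N → *-congˡ (altConv-e-h (<⇒≤ b<N) m)) ⟩
    twoColumnᵉ N (suc q) 0 m
      ≈⟨ twoColumnᵉ≈pieri N (suc q) 0 m ⟩
    twoColumn N (suc q) m 0 0 + 0#
      ≈⟨ +-identityʳ _ ⟩
    twoColumn N (suc q) m 0 0 ∎

module Tableaux {c ℓ} (R : CommutativeRing c ℓ) {n : ℕ} (x : Fin n → CommutativeRing.Carrier R) where
  open CommutativeRing R hiding (zero)
  open FiniteSums R
  open import Relation.Binary.Reasoning.Setoid setoid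
  open import Algebra.Solver.Ring.NaturalCoefficients.Default commutativeSemiring using (solve; _:=_; _:*_)

  X : ℕ → Carrier
  X = extendBy 0# x

  x≈X : ∀ i → x i ≈ X (toℕ i)
  x≈X i = reflexive (≡.sym (extendBy-toℕ 0# x i))

  open SymmetricPolynomials R X

  Row : Set
  Row = List (Fin n)

  prod : Row → Carrier
  prod r = prodR R (map x r)

  prod-++ : ∀ r s → prod (r ++ s) ≈ prod r * prod s
  prod-++ [] s = sym (*-identityˡ _)
  prod-++ (i ∷ r) s = trans (*-congˡ (prod-++ r s)) (sym (*-assoc _ _ _))

  ∑-allLists-suc : ∀ l (F : Row → Carrier) →
                   ∑ᴸ (allLists n (suc l)) F ≈ ∑[ i ∈ allFin n ] ∑[ w ∈ allLists n l ] F (i ∷ w)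
  ∑-allLists-suc l F = trans (∑∈-concatMap (allFin n) _ F) (∑∈-cong (allFin n) λ i → ∑∈-map (allLists n l) _ F)

  ∑-firstLetter : ∀ l γ (B : Fin n → Row → Bool) (g : ℕ → Carrier) →
    (∀ i → ∑[ w ∈ allLists n l ] 𝟙[ B i w ] (prod w) ≈ g (toℕ i)) →
    ∑[ i ∈ allFin n ] ∑[ w ∈ allLists n l ] 𝟙[ (γ ≤ᵇ toℕ i) ∧ B i w ] (x i * prod w)
      ≈ ∑[ a < n ] (𝟙[ γ ≤ᵇ a ] (X a) * g a)
  ∑-firstLetter l γ B g sum≈g = ∑∈-tabulate n _ _ _ λ i →
    trans (∑∈-𝟙-* (allLists n l) (γ ≤ᵇ toℕ i) (x i) (B i) prod)
          (*-cong (𝟙-cong (γ ≤ᵇ toℕ i) (x≈X i)) (sum≈g i))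

  ∑-weakInc≈h : ∀ j c → ∑[ w ∈ allLists n j ] 𝟙[ weakInc (c ∷ w) ] (prod w) ≈ h n j (toℕ c)
  ∑-weakInc≈h zero c = +-identityʳ 1#
  ∑-weakInc≈h (suc j) c =
    trans (∑-allLists-suc j _) (∑-firstLetter j (toℕ c) (λ i w → weakInc (i ∷ w)) _ (∑-weakInc≈h j))

  strictIncFrom : ℕ → Row → Bool
  strictIncFrom α [] = true
  strictIncFrom α (i ∷ w) = (α ≤ᵇ toℕ i) ∧ strictIncFrom (suc (toℕ i)) w

  strictInc≡strictIncFrom : ∀ w → strictInc w ≡ strictIncFrom 0 w
  strictInc≡strictIncFrom [] = ≡.refl
  strictInc≡strictIncFrom (i ∷ w) = go i w
    where
    go : ∀ i w → strictInc (i ∷ w) ≡ strictIncFrom (suc (toℕ i)) w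
    go i [] = ≡.refl
    go i (j ∷ w) = ≡.cong ((toℕ i <ᵇ toℕ j) ∧_) (go j w)

  ∑-strictIncFrom≈e : ∀ r α → ∑[ w ∈ allLists n r ] 𝟙[ strictIncFrom α w ] (prod w) ≈ e n r α
  ∑-strictIncFrom≈e zero α = +-identityʳ 1#
  ∑-strictIncFrom≈e (suc r) α = trans (∑-allLists-suc r _)
    (∑-firstLetter r α (λ i → strictIncFrom (suc (toℕ i))) _ (λ i → ∑-strictIncFrom≈e r (suc (toℕ i))))

  elem≈e : ∀ r → elem R x r ≈ e n r 0
  elem≈e r = begin
    elem R x r
      ≈⟨ ∑∈-filter (allLists n r) strictInc prod ⟩
    ∑[ w ∈ allLists n r ] 𝟙[ strictInc w ] (prod w)
      ≈⟨ ∑∈-cong (allLists n r) (λ w → reflexive (≡.cong (λ b → 𝟙[ b ] (prod w))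
                                                         (strictInc≡strictIncFrom w))) ⟩
    ∑[ w ∈ allLists n r ] 𝟙[ strictIncFrom 0 w ] (prod w)
      ≈⟨ ∑-strictIncFrom≈e r 0 ⟩
    e n r 0 ∎

  below : Maybe Row → Row → Bool
  below nothing r = true
  below (just p) r = colStrict p r

  firstRowBelow : Maybe Row → List Row → Bool
  firstRowBelow p [] = true
  firstRowBelow p (r ∷ T) = below p r

  weight : List Row → Carrier
  weight T = prodR R (map x (concat T))

  -- rowSum p sh sums x^T over the semistandard tableaux T of shape sh whose first row fits below the row p.
  rowSum : Maybe Row → List ℕ → Carrier
  rowSum p [] = 1#
  rowSum p (l ∷ ls) = ∑[ r ∈ allLists n l ] (𝟙[ weakInc r ∧ below p r ] (prod r) * rowSum (just r) ls)

  colsOK-∷ : ∀ r T → colsOK (r ∷ T) ≡ firstRowBelow (just r) T ∧ colsOK T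
  colsOK-∷ r [] = ≡.refl
  colsOK-∷ r (_ ∷ _) = ≡.refl

  ∧-shuffle : ∀ b w a f c → b ∧ ((w ∧ a) ∧ (f ∧ c)) ≡ (w ∧ b) ∧ (f ∧ (a ∧ c))
  ∧-shuffle false true a f c = ≡.refl
  ∧-shuffle false false a f c = ≡.refl
  ∧-shuffle true false a f c = ≡.refl
  ∧-shuffle true true true f c = ≡.refl
  ∧-shuffle true true false true c = ≡.refl
  ∧-shuffle true true false false c = ≡.refl

  isSSYT-∷ : ∀ p r T →
    firstRowBelow p (r ∷ T) ∧ isSSYT (r ∷ T) ≡ (weakInc r ∧ below p r) ∧ (firstRowBelow (just r) T ∧ isSSYT T)
  isSSYT-∷ p r T rewrite colsOK-∷ r T =
    ∧-shuffle (below p r) (weakInc r) (allᵇ weakInc T) (firstRowBelow (just r) T) (colsOK T)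

  ∑-SSYT≈rowSum : ∀ p sh → ∑[ T ∈ fillings n sh ] 𝟙[ firstRowBelow p T ∧ isSSYT T ] (weight T) ≈ rowSum p sh
  ∑-SSYT≈rowSum p [] = +-identityʳ 1#
  ∑-SSYT≈rowSum p (l ∷ ls) = begin
    ∑[ T ∈ fillings n (l ∷ ls) ] 𝟙[ firstRowBelow p T ∧ isSSYT T ] (weight T)
      ≈⟨ trans (∑∈-concatMap (allLists n l) _ _) (∑∈-cong (allLists n l) λ r → ∑∈-map (fillings n ls) _ _) ⟩
    ∑[ r ∈ allLists n l ] ∑[ T ∈ fillings n ls ] 𝟙[ firstRowBelow p (r ∷ T) ∧ isSSYT (r ∷ T) ] (weight (r ∷ T))
      ≈⟨ ∑∈-cong (allLists n l) (λ r → ∑∈-cong (fillings n ls) λ T →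
           trans (reflexive (≡.cong (λ b → 𝟙[ b ] (weight (r ∷ T))) (isSSYT-∷ p r T)))
                 (𝟙-cong ((weakInc r ∧ below p r) ∧ _) (prod-++ r (concat T)))) ⟩
    ∑[ r ∈ allLists n l ] ∑[ T ∈ fillings n ls ]
      𝟙[ (weakInc r ∧ below p r) ∧ (firstRowBelow (just r) T ∧ isSSYT T) ] (prod r * weight T)
      ≈⟨ ∑∈-cong (allLists n l) (λ r → ∑∈-𝟙-* (fillings n ls) (weakInc r ∧ below p r) (prod r) _ weight) ⟩
    ∑[ r ∈ allLists n l ] (𝟙[ weakInc r ∧ below p r ] (prod r)
      * ∑[ T ∈ fillings n ls ] 𝟙[ firstRowBelow (just r) T ∧ isSSYT T ] (weight T))
      ≈⟨ ∑∈-cong (allLists n l) (λ r → *-congˡ (∑-SSYT≈rowSum (just r) ls)) ⟩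
    rowSum p (l ∷ ls) ∎

  schur≈rowSum : ∀ sh → schur R x sh ≈ rowSum nothing sh
  schur≈rowSum sh = begin
    schur R x sh
      ≈⟨ ∑∈-filter (fillings n sh) isSSYT weight ⟩
    ∑[ T ∈ fillings n sh ] 𝟙[ isSSYT T ] (weight T)
      ≈⟨ ∑∈-cong (fillings n sh) noConstraint ⟩
    ∑[ T ∈ fillings n sh ] 𝟙[ firstRowBelow nothing T ∧ isSSYT T ] (weight T)
      ≈⟨ ∑-SSYT≈rowSum nothing sh ⟩
    rowSum nothing sh ∎
    where
    noConstraint : ∀ T → 𝟙[ isSSYT T ] (weight T) ≈ 𝟙[ firstRowBelow nothing T ∧ isSSYT T ] (weight T)
    noConstraint [] = refl
    noConstraint (r ∷ T) = refl

  rowSum-column : ∀ d p α → (∀ i → below p [ i ] ≡ (α ≤ᵇ toℕ i)) → rowSum p (replicate d 1) ≈ e n d α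
  rowSum-column zero p α below≡ = refl
  rowSum-column (suc d) p α below≡ = trans (∑-allLists-suc 0 _) (∑∈-tabulate n _ _ _ λ i →
    trans (+-identityʳ _)
      (*-cong (trans (reflexive (≡.cong (λ b → 𝟙[ b ] (x i * 1#)) (below≡ i)))
                     (𝟙-cong (α ≤ᵇ toℕ i) (trans (*-identityʳ (x i)) (x≈X i))))
              (rowSum-column d (just [ i ]) (suc (toℕ i)) λ _ → ∧-identityʳ _)))

  below-pair : ∀ i j t i′ j′ →
    below (just (i ∷ j ∷ t)) (i′ ∷ j′ ∷ []) ≡ (suc (toℕ i) ≤ᵇ toℕ i′) ∧ (suc (toℕ j) ≤ᵇ toℕ j′)
  below-pair i j t i′ j′ = ≡.cong ((toℕ i <ᵇ toℕ i′) ∧_) (∧-identityʳ _)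

  below-single : ∀ i j t i′ → below (just (i ∷ j ∷ t)) [ i′ ] ≡ (suc (toℕ i) ≤ᵇ toℕ i′)
  below-single i j t i′ = ∧-identityʳ _

  rowSum-twoColumn : ∀ q d p α β →
    (∀ i j → below p (i ∷ j ∷ []) ≡ (α ≤ᵇ toℕ i) ∧ (β ≤ᵇ toℕ j)) →
    (∀ i → below p [ i ] ≡ (α ≤ᵇ toℕ i)) →
    rowSum p (replicate q 2 ++ replicate d 1) ≈ twoColumn n q d α β
  rowSum-twoColumn zero d p α β _ below₁≡ = rowSum-column d p α below₁≡
  rowSum-twoColumn (suc q) d p α β below₂≡ below₁≡ =
    trans (∑-allLists-suc 1 _) (∑∈-tabulate n _ _ _ λ i →
      trans (∑-allLists-suc 0 _) (∑∈-tabulate n _ _ _ λ j →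
        trans (+-identityʳ _) (*-cong (coefficient i j)
          (rowSum-twoColumn q d (just (i ∷ j ∷ [])) _ _ (below-pair i j []) (below-single i j [])))))
    where
    coefficient : ∀ i j → 𝟙[ weakInc (i ∷ j ∷ []) ∧ below p (i ∷ j ∷ []) ] (x i * (x j * 1#))
                          ≈ topCoeff α β (toℕ i) (toℕ j)
    coefficient i j rewrite below₂≡ i j = begin
      𝟙[ ((toℕ i ≤ᵇ toℕ j) ∧ true) ∧ ((α ≤ᵇ toℕ i) ∧ (β ≤ᵇ toℕ j)) ] (x i * (x j * 1#))
        ≈⟨ reflexive (≡.cong (λ b → 𝟙[ b ∧ ((α ≤ᵇ toℕ i) ∧ (β ≤ᵇ toℕ j)) ] (x i * (x j * 1#)))
                             (∧-identityʳ (toℕ i ≤ᵇ toℕ j))) ⟩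
      𝟙[ (toℕ i ≤ᵇ toℕ j) ∧ ((α ≤ᵇ toℕ i) ∧ (β ≤ᵇ toℕ j)) ] (x i * (x j * 1#))
        ≈⟨ trans (𝟙-∧ (toℕ i ≤ᵇ toℕ j) _ _)
                 (𝟙-cong (toℕ i ≤ᵇ toℕ j) (𝟙-∧ (α ≤ᵇ toℕ i) (β ≤ᵇ toℕ j) _)) ⟩
      𝟙[ toℕ i ≤ᵇ toℕ j ] (𝟙[ α ≤ᵇ toℕ i ] (𝟙[ β ≤ᵇ toℕ j ] (x i * (x j * 1#))))
        ≈⟨ 𝟙-cong (toℕ i ≤ᵇ toℕ j) (𝟙-cong (α ≤ᵇ toℕ i) (𝟙-cong (β ≤ᵇ toℕ j)
             (*-cong (x≈X i) (trans (*-identityʳ (x j)) (x≈X j))))) ⟩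
      topCoeff α β (toℕ i) (toℕ j) ∎

  schur-twoColumn : ∀ q d → schur R x (replicate q 2 ++ replicate d 1) ≈ twoColumn n q d 0 0
  schur-twoColumn q d = trans (schur≈rowSum (replicate q 2 ++ replicate d 1))
                              (rowSum-twoColumn q d nothing 0 0 (λ _ _ → ≡.refl) (λ _ → ≡.refl))

  schur-hook : ∀ j q → schur R x (suc (suc j) ∷ replicate q 2) ≈ twoColumnʷ n (suc q) 0 0 0 (h n j)
  schur-hook j q =
    trans (schur≈rowSum (suc (suc j) ∷ replicate q 2)) (trans (∑-allLists-suc (suc j) _) (∑∈-tabulate n _ _ _ λ i →
      trans (∑-allLists-suc j _) (∑∈-tabulate n _ _ _ λ i₂ → topRow i i₂)))
    where
    topRow : ∀ i i₂ →
      ∑[ t ∈ allLists n j ] (𝟙[ weakInc (i ∷ i₂ ∷ t) ∧ true ] (x i * (x i₂ * prod t))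
                             * rowSum (just (i ∷ i₂ ∷ t)) (replicate q 2))
        ≈ topCoeff 0 0 (toℕ i) (toℕ i₂) * (twoColumn n q 0 (suc (toℕ i)) (suc (toℕ i₂)) * h n j (toℕ i₂))
    topRow i i₂ = begin
      ∑[ t ∈ allLists n j ] (𝟙[ (i≤i₂ ∧ W t) ∧ true ] (x i * (x i₂ * prod t))
                             * rowSum (just (i ∷ i₂ ∷ t)) (replicate q 2))
        ≈⟨ ∑∈-cong (allLists n j) summand ⟩
      ∑[ t ∈ allLists n j ] 𝟙[ i≤i₂ ∧ W t ] (x i * x i₂ * P * prod t)
        ≈⟨ ∑∈-𝟙-* (allLists n j) i≤i₂ (x i * x i₂ * P) W prod ⟩
      𝟙[ i≤i₂ ] (x i * x i₂ * P) * ∑[ t ∈ allLists n j ] 𝟙[ W t ] (prod t)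
        ≈⟨ *-cong (𝟙-*ʳ i≤i₂ _ P) (∑-weakInc≈h j i₂) ⟩
      𝟙[ i≤i₂ ] (x i * x i₂) * P * h n j (toℕ i₂)
        ≈⟨ trans (*-assoc _ _ _) (*-congʳ (𝟙-cong i≤i₂ (*-cong (x≈X i) (x≈X i₂)))) ⟩
      topCoeff 0 0 (toℕ i) (toℕ i₂) * (P * h n j (toℕ i₂)) ∎
      where
      i≤i₂ : Bool
      i≤i₂ = toℕ i ≤ᵇ toℕ i₂
      W : Row → Bool
      W t = weakInc (i₂ ∷ t)
      P : Carrier
      P = twoColumn n q 0 (suc (toℕ i)) (suc (toℕ i₂))
      rearrange : ∀ a b w p → a * (b * w) * p ≈ a * b * p * w
      rearrange = solve 4 (λ a b w p → a :* (b :* w) :* p := a :* b :* p :* w) refl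
      summand : ∀ t →
        𝟙[ (i≤i₂ ∧ W t) ∧ true ] (x i * (x i₂ * prod t)) * rowSum (just (i ∷ i₂ ∷ t)) (replicate q 2)
          ≈ 𝟙[ i≤i₂ ∧ W t ] (x i * x i₂ * P * prod t)
      summand t = begin
        𝟙[ (i≤i₂ ∧ W t) ∧ true ] (x i * (x i₂ * prod t)) * rowSum (just (i ∷ i₂ ∷ t)) (replicate q 2)
          ≈⟨ *-cong (reflexive (≡.cong (λ b → 𝟙[ b ] (x i * (x i₂ * prod t))) (∧-identityʳ (i≤i₂ ∧ W t))))
                    (≡.subst (λ sh → rowSum (just (i ∷ i₂ ∷ t)) sh ≈ P) (++-identityʳ (replicate q 2))
                             (rowSum-twoColumn q 0 _ _ _ (below-pair i i₂ t) (below-single i i₂ t))) ⟩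
        𝟙[ i≤i₂ ∧ W t ] (x i * (x i₂ * prod t)) * P
          ≈⟨ trans (sym (𝟙-*ʳ (i≤i₂ ∧ W t) _ P))
                   (𝟙-cong (i≤i₂ ∧ W t) (rearrange (x i) (x i₂) (prod t) P)) ⟩
        𝟙[ i≤i₂ ∧ W t ] (x i * x i₂ * P * prod t) ∎

lemma2p2 : ∀ {c ℓ} (R : CommutativeRing c ℓ) (n : ℕ) (x : Fin n → CommutativeRing.Carrier R) (m k : ℕ) → 1 ≤ k →
    CommutativeRing._≈_ R (lhs R x m k) (rhs R x m k)
lemma2p2 R n x m (suc q) _ = begin
  lhs R x m (suc q)
    ≈⟨ ∑∈-applyUpTo (suc m) id _ ⟩
  ∑[ j < suc m ] (negOnePow R j * (elem R x (m ∸ j) * schur R x (suc (suc j) ∷ replicate q 2)))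
    ≈⟨ ∑-cong (suc m) (λ j _ → *-congˡ (*-cong (elem≈e (m ∸ j)) (schur-hook j q))) ⟩
  ∑[ j < suc m ] (negOnePow R j * (e n (m ∸ j) 0 * twoColumnʷ n (suc q) 0 0 0 (h n j)))
    ≈⟨ altConv-as-∑ m _ _ ⟩
  altConv (λ r → e n r 0) (λ j → twoColumnʷ n (suc q) 0 0 0 (h n j)) m
    ≈⟨ altConv-e-twoColumnʷ-h n q m ⟩
  twoColumn n (suc q) m 0 0
    ≈⟨ sym (schur-twoColumn (suc q) m) ⟩
  rhs R x m (suc q) ∎
  where
  open CommutativeRing R
  open import Relation.Binary.Reasoning.Setoid setoid
  open FiniteSums R
  open Tableaux R x
  open AlternatingConvolution R
  open SymmetricPolynomials R (extendBy 0# x)
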